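{- Let $G$ and $G'$ be two-edge connected non-bipartite finite simple graphs, where $G'$ is obtained from $G$ by adding an ear of length at most seven, i.e., by adding a path $v_0e_1v_1\cdots e_\ell v_\ell$ with $1\leq \ell\leq 7$, where $v_0,v_\ell\in V(G)$ (possibly $v_0=v_\ell$), $v_1,\dots,v_{\ell-1}$ are new vertices not in $G$, and $e_1,\dots,e_\ell$ are new edges. If $G$ is all-round, then $G'$ is all-round.
   Context: For a graph $H=(V,E)$ and $f\colon V\to\{0,1,2,3\}$, a connected mod-4 $f$-factor is a vector $\mathbf{x}\in\{0,1,2,3\}^E$ with $\sum_{e\in\delta(v)}x_e\equiv f(v)\pmod 4$ for all $v\in V$ ($\delta(v)$ = edges incident to $v$) such that the graph $(V,\{e\in E\mid x_e>0\})$ is connected. $H$ is all-round if it has a connected mod-4 $f$-factor for every $f\colon V\to\{0,1,2,3\}$ with $\sum_{v\in V}f(v)$ even. -}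

module Defs where

open import Data.Nat using (ℕ; zero; suc; _+_; _*_; _%_)
open import Data.Nat.Divisibility using (_∣_)
open import Data.Fin using (Fin; zero; suc; toℕ; _↑ˡ_; _↑ʳ_; splitAt; inject₁)
open import Data.Fin.Properties using () renaming (_≟_ to _≟ᶠ_)
open import Data.Bool using (Bool)
open import Data.Product using (Σ; ∃; _×_; _,_; proj₁; proj₂)
open import Data.Sum using (_⊎_; inj₁; inj₂)
open import Data.Unit using (⊤; tt)
open import Relation.Nullary using (¬_; yes; no)
open import Relation.Binary.PropositionalEquality using (_≡_; _≢_)

record Graph : Set where
  field
    n    : ℕ
    m    : ℕ
    ends : Fin m → Fin n × Fin n
open Graph public

sumFin : (k : ℕ) → (Fin k → ℕ) → ℕ
sumFin zero    g = 0
sumFin (suc k) g = g zero + sumFin k (λ i → g (suc i))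

Simple : Graph → Set
Simple G = (∀ e → proj₁ (ends G e) ≢ proj₂ (ends G e))
         × (∀ e e' → (ends G e ≡ ends G e'
                       ⊎ (proj₁ (ends G e) ≡ proj₂ (ends G e') × proj₂ (ends G e) ≡ proj₁ (ends G e')))
                   → e ≡ e')

Joins : (G : Graph) → Fin (m G) → Fin (n G) → Fin (n G) → Set
Joins G e u w = ends G e ≡ (u , w) ⊎ ends G e ≡ (w , u)

data Reach (G : Graph) (S : Fin (m G) → Set) : Fin (n G) → Fin (n G) → Set where
  here : ∀ {u} → Reach G S u u
  step : ∀ {u w v} (e : Fin (m G)) → S e → Joins G e u w → Reach G S w v → Reach G S u v

ConnectedVia : (G : Graph) → (Fin (m G) → Set) → Set
ConnectedVia G S = ∀ u v → Reach G S u v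

Connected : Graph → Set
Connected G = ConnectedVia G (λ _ → ⊤)

TwoEdgeConnected : Graph → Set
TwoEdgeConnected G = Connected G × (∀ e → ConnectedVia G (λ e' → e' ≢ e))

Bipartite : Graph → Set
Bipartite G = Σ (Fin (n G) → Bool) λ c → ∀ e → c (proj₁ (ends G e)) ≢ c (proj₂ (ends G e))

NonBipartite : Graph → Set
NonBipartite G = ¬ Bipartite G

incid : (G : Graph) → Fin (m G) → Fin (n G) → ℕ
incid G e v = ind (proj₁ (ends G e)) + ind (proj₂ (ends G e))
  where
  ind : Fin (n G) → ℕ
  ind u with u ≟ᶠ v
  ... | yes _ = 1
  ... | no  _ = 0

degSum : (G : Graph) → (Fin (m G) → Fin 4) → Fin (n G) → ℕ
degSum G x v = sumFin (m G) (λ e → toℕ (x e) * incid G e v)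

ConnModFactor : (G : Graph) → (Fin (n G) → Fin 4) → (Fin (m G) → Fin 4) → Set
ConnModFactor G f x = (∀ v → degSum G x v % 4 ≡ toℕ (f v) % 4)
                    × ConnectedVia G (λ e → x e ≢ zero)

AllRound : Graph → Set
AllRound G = ∀ (f : Fin (n G) → Fin 4)
           → 2 ∣ sumFin (n G) (λ v → toℕ (f v))
           → ∃ λ (x : Fin (m G) → Fin 4) → ConnModFactor G f x

-- classify j ∈ {0..k}: inj₁ i for j = i < k (an inner index), inj₂ tt for j = k
inner : (k : ℕ) → Fin (suc k) → Fin k ⊎ ⊤
inner zero    zero    = inj₂ tt
inner (suc k) zero    = inj₁ zero
inner (suc k) (suc j) with inner k j
... | inj₁ i  = inj₁ (suc i)
... | inj₂ t  = inj₂ t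

-- Ear with k new inner vertices (length ℓ = k+1), from v0 to vl.
-- Path vertex p_0 = v0, p_j = new vertex (n + j - 1) for 1 ≤ j ≤ k, p_{k+1} = vl.
earVert : (n k : ℕ) → Fin n → Fin n → Fin (suc (suc k)) → Fin (n + k)
earVert n k v0 vl zero = v0 ↑ˡ k
earVert n k v0 vl (suc j) with inner k j
... | inj₁ i = n ↑ʳ i
... | inj₂ _ = vl ↑ˡ k

-- G' = G plus the ear v0 e1 p1 ... e_{k+1} vl; new edges are m, …, m+k.
addEar : (G : Graph) (k : ℕ) → Fin (n G) → Fin (n G) → Graph
addEar G k v0 vl = record
  { n = n G + k
  ; m = m G + suc k
  ; ends = λ e → go (splitAt (m G) e)
  }
  where
  go : Fin (m G) ⊎ Fin (suc k) → Fin (n G + k) × Fin (n G + k)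
  go (inj₁ e) = (proj₁ (ends G e) ↑ˡ k) , (proj₂ (ends G e) ↑ˡ k)
  go (inj₂ i) = earVert (n G) k v0 vl (inject₁ i) , earVert (n G) k v0 vl (suc i)

module Submission where

-- Give the first ear edge the label t ∈ ℤ/4. The mod-4 conditions at the k inner vertices
-- then force the labels of all k + 1 ear edges, and each ear edge gets label 0 for exactly
-- one t; as k + 1 ≤ 7 < 2 · 4, some t leaves at most one ear edge with label 0, so every
-- inner vertex stays joined to an end of the ear in the support. Subtracting the labels of
-- the first and last ear edge from f at the ends of the ear gives a target on G whose total
-- has the parity of Σ f (every ear label is counted twice along the ear); a connected mod-4
-- factor of G for it, together with the ear labels, is a connected mod-4 f-factor of G′.

open import Defs
open import Data.Nat using (ℕ; zero; suc; _+_; _*_; _%_; _/_; _≤_; _<_; z≤n; s≤s; _<?_; NonZero)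
open import Data.Nat.Properties hiding (suc-injective)
open import Data.Nat.DivMod using (_mod_; m%n<n; %-distribˡ-+; [m+kn]%n≡m%n; m≡m%n+[m/n]*n; m%n%n≡m%n)
open import Data.Nat.Divisibility using (_∣_; divides; ∣m+n∣m⇒∣n; ∣m∣n⇒∣m+n; n∣m*n)
open import Data.Nat.Tactic.RingSolver using (solve-∀)
open import Data.Fin using (Fin; zero; suc; toℕ; _↑ˡ_; _↑ʳ_; splitAt; inject₁; fromℕ)
open import Data.Fin.Properties
  using (toℕ-fromℕ<; ↑ˡ-injective; ↑ʳ-injective; suc-injective;
         splitAt-↑ˡ; splitAt-↑ʳ; splitAt⁻¹-↑ˡ; splitAt⁻¹-↑ʳ; any?; all?)
  renaming (_≟_ to _≟ᶠ_)
open import Data.Product using (∃; _,_; proj₁; proj₂)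
open import Data.Sum using (_⊎_; inj₁; inj₂; [_,_])
open import Data.Unit using (tt)
open import Function using (_∘_)
open import Relation.Nullary using (yes; no; contradiction)
open import Relation.Nullary.Decidable using (toWitness; _×-dec_)
open import Relation.Binary.PropositionalEquality hiding ([_])
open ≡-Reasoning

-- Finite sums

sumFin-cong : ∀ k {g h : Fin k → ℕ} → (∀ i → g i ≡ h i) → sumFin k g ≡ sumFin k h
sumFin-cong zero    eq = refl
sumFin-cong (suc k) eq = cong₂ _+_ (eq zero) (sumFin-cong k (eq ∘ suc))

sumFin-zero : ∀ k {g : Fin k → ℕ} → (∀ i → g i ≡ 0) → sumFin k g ≡ 0
sumFin-zero zero    eq = refl
sumFin-zero (suc k) eq = cong₂ _+_ (eq zero) (sumFin-zero k (eq ∘ suc))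

sumFin-1 : ∀ k → sumFin k (λ _ → 1) ≡ k
sumFin-1 zero    = refl
sumFin-1 (suc k) = cong suc (sumFin-1 k)

sumFin-distrib-+ : ∀ k (g h : Fin k → ℕ) →
                   sumFin k (λ i → g i + h i) ≡ sumFin k g + sumFin k h
sumFin-distrib-+ zero    g h = refl
sumFin-distrib-+ (suc k) g h = begin
  g zero + h zero + sumFin k (λ i → g (suc i) + h (suc i))
    ≡⟨ cong (g zero + h zero +_) (sumFin-distrib-+ k (g ∘ suc) (h ∘ suc)) ⟩
  g zero + h zero + (sumFin k (g ∘ suc) + sumFin k (h ∘ suc))
    ≡⟨ +-+-swap (g zero) (h zero) _ _ ⟩
  g zero + sumFin k (g ∘ suc) + (h zero + sumFin k (h ∘ suc)) ∎
  where
  +-+-swap : ∀ a b c d → a + b + (c + d) ≡ a + c + (b + d)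
  +-+-swap = solve-∀

sumFin-++ : ∀ a b (g : Fin (a + b) → ℕ) →
            sumFin (a + b) g ≡ sumFin a (λ i → g (i ↑ˡ b)) + sumFin b (λ i → g (a ↑ʳ i))
sumFin-++ zero    b g = refl
sumFin-++ (suc a) b g =
  trans (cong (g zero +_) (sumFin-++ a b (g ∘ suc))) (sym (+-assoc (g zero) _ _))

sumFin-init-last : ∀ k (g : Fin (suc k) → ℕ) →
                   sumFin (suc k) g ≡ sumFin k (g ∘ inject₁) + g (fromℕ k)
sumFin-init-last zero    g = +-comm (g zero) 0
sumFin-init-last (suc k) g =
  trans (cong (g zero +_) (sumFin-init-last k (g ∘ suc))) (sym (+-assoc (g zero) _ _))

sumFin-comm : ∀ a b (h : Fin a → Fin b → ℕ) →
              sumFin a (λ i → sumFin b (h i)) ≡ sumFin b (λ j → sumFin a (λ i → h i j))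
sumFin-comm zero    b h = sym (sumFin-zero b (λ _ → refl))
sumFin-comm (suc a) b h =
  trans (cong (sumFin b (h zero) +_) (sumFin-comm a b (h ∘ suc)))
        (sym (sumFin-distrib-+ b (h zero) (λ j → sumFin a (λ i → h (suc i) j))))

sumFin-path : ∀ k (w : Fin (suc k) → ℕ) (a : Fin (suc (suc k)) → ℕ) →
  sumFin (suc k) (λ i → w i * (a (inject₁ i) + a (suc i)))
  ≡ w zero * a zero
    + sumFin k (λ i → (w (suc i) + w (inject₁ i)) * a (suc (inject₁ i)))
    + w (fromℕ k) * a (fromℕ (suc k))
sumFin-path k w a = begin
  sumFin (suc k) (λ i → w i * (a (inject₁ i) + a (suc i)))
    ≡⟨ sumFin-cong (suc k) (λ i → *-distribˡ-+ (w i) (a (inject₁ i)) (a (suc i))) ⟩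
  sumFin (suc k) (λ i → w i * a (inject₁ i) + w i * a (suc i))
    ≡⟨ sumFin-distrib-+ (suc k) (λ i → w i * a (inject₁ i)) (λ i → w i * a (suc i)) ⟩
  (w zero * a zero + B) + sumFin (suc k) (λ i → w i * a (suc i))
    ≡⟨ cong (w zero * a zero + B +_) (sumFin-init-last k (λ i → w i * a (suc i))) ⟩
  (w zero * a zero + B) + (C + w (fromℕ k) * a (fromℕ (suc k)))
    ≡⟨ regroup (w zero * a zero) B C _ ⟩
  w zero * a zero + (B + C) + w (fromℕ k) * a (fromℕ (suc k))
    ≡⟨ cong (λ s → w zero * a zero + s + w (fromℕ k) * a (fromℕ (suc k))) B+C ⟩
  w zero * a zero
    + sumFin k (λ i → (w (suc i) + w (inject₁ i)) * a (suc (inject₁ i)))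
    + w (fromℕ k) * a (fromℕ (suc k)) ∎
  where
  B C : ℕ
  B = sumFin k (λ i → w (suc i) * a (suc (inject₁ i)))
  C = sumFin k (λ i → w (inject₁ i) * a (suc (inject₁ i)))
  regroup : ∀ x y z t → x + y + (z + t) ≡ x + (y + z) + t
  regroup = solve-∀
  B+C : B + C ≡ sumFin k (λ i → (w (suc i) + w (inject₁ i)) * a (suc (inject₁ i)))
  B+C = trans (sym (sumFin-distrib-+ k (λ i → w (suc i) * a (suc (inject₁ i)))
                                       (λ i → w (inject₁ i) * a (suc (inject₁ i)))))
              (sumFin-cong k (λ i → sym (*-distribʳ-+ (a (suc (inject₁ i))) (w (suc i)) _)))

sumFin-adjacent : ∀ k (w : Fin (suc k) → ℕ) →
  sumFin k (λ i → w (suc i) + w (inject₁ i)) + (w zero + w (fromℕ k)) ≡ 2 * sumFin (suc k) w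
sumFin-adjacent zero    w = double (w zero)
  where
  double : ∀ x → 0 + (x + x) ≡ 2 * (x + 0)
  double = solve-∀
sumFin-adjacent (suc k) w = begin
  w (suc zero) + w zero + S + (w zero + w (fromℕ (suc k)))
    ≡⟨ regroup (w zero) (w (suc zero)) S (w (fromℕ (suc k))) ⟩
  2 * w zero + (S + (w (suc zero) + w (fromℕ (suc k))))
    ≡⟨ cong (2 * w zero +_) (sumFin-adjacent k (w ∘ suc)) ⟩
  2 * w zero + 2 * sumFin (suc k) (w ∘ suc)
    ≡⟨ *-distribˡ-+ 2 (w zero) _ ⟨
  2 * sumFin (suc (suc k)) w ∎
  where
  S = sumFin k (λ i → w (suc (suc i)) + w (suc (inject₁ i)))
  regroup : ∀ a b s l → b + a + s + (a + l) ≡ 2 * a + (s + (b + l))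
  regroup = solve-∀

sumFin-≥-term : ∀ k (h : Fin k → ℕ) i → h i ≤ sumFin k h
sumFin-≥-term (suc k) h zero    = m≤m+n (h zero) _
sumFin-≥-term (suc k) h (suc i) = ≤-trans (sumFin-≥-term k (h ∘ suc) i) (m≤n+m _ (h zero))

sumFin-≥-pair : ∀ k (h : Fin k → ℕ) {i j} → i ≢ j → h i + h j ≤ sumFin k h
sumFin-≥-pair (suc k) h {zero}  {zero}  i≢j = contradiction refl i≢j
sumFin-≥-pair (suc k) h {zero}  {suc j} i≢j =
  +-monoʳ-≤ (h zero) (sumFin-≥-term k (h ∘ suc) j)
sumFin-≥-pair (suc k) h {suc i} {zero}  i≢j =
  subst (_≤ sumFin (suc k) h) (+-comm (h zero) _) (+-monoʳ-≤ (h zero) (sumFin-≥-term k (h ∘ suc) i))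
sumFin-≥-pair (suc k) h {suc i} {suc j} i≢j =
  ≤-trans (sumFin-≥-pair k (h ∘ suc) (i≢j ∘ cong suc)) (m≤n+m _ (h zero))

∣-sumFin : ∀ {d} k (h : Fin k → ℕ) → (∀ i → d ∣ h i) → d ∣ sumFin k h
∣-sumFin zero    h d∣h = divides 0 refl
∣-sumFin (suc k) h d∣h = ∣m∣n⇒∣m+n (d∣h zero) (∣-sumFin k (h ∘ suc) (d∣h ∘ suc))

pigeonhole : ∀ k b (c : Fin k → ℕ) → sumFin k c < k * b → ∃ λ i → c i < b
pigeonhole zero    b c ()
pigeonhole (suc k) b c sum< with c zero <? b
... | yes c₀<b = zero , c₀<b
... | no  c₀≮b =
  let (i , cᵢ<b) = pigeonhole k b (c ∘ suc)
                     (+-cancelˡ-< b _ _ (≤-<-trans (+-monoˡ-≤ _ (≮⇒≥ c₀≮b)) sum<))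
  in suc i , cᵢ<b

-- Kronecker delta

δ : ∀ {a} → Fin a → Fin a → ℕ
δ x y with x ≟ᶠ y
... | yes _ = 1
... | no  _ = 0

module _ {a} {x y : Fin a} where

  δ-≡ : x ≡ y → δ x y ≡ 1
  δ-≡ x≡y with x ≟ᶠ y
  ... | yes _   = refl
  ... | no  x≢y = contradiction x≡y x≢y

  δ-≢ : x ≢ y → δ x y ≡ 0
  δ-≢ x≢y with x ≟ᶠ y
  ... | yes x≡y = contradiction x≡y x≢y
  ... | no  _   = refl

δ-sym : ∀ {a} (x y : Fin a) → δ x y ≡ δ y x
δ-sym x y with x ≟ᶠ y
... | yes x≡y = sym (δ-≡ (sym x≡y))
... | no  x≢y = sym (δ-≢ (x≢y ∘ sym))

δ-injective : ∀ {a b} (h : Fin a → Fin b) → (∀ {x y} → h x ≡ h y → x ≡ y) →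
              ∀ x y → δ (h x) (h y) ≡ δ x y
δ-injective h h-inj x y with x ≟ᶠ y
... | yes x≡y = δ-≡ (cong h x≡y)
... | no  x≢y = δ-≢ (x≢y ∘ h-inj)

sumFin-*δ : ∀ k (h : Fin k → ℕ) j → sumFin k (λ i → h i * δ i j) ≡ h j
sumFin-*δ (suc k) h zero = begin
  sumFin (suc k) (λ i → h i * δ i zero)
    ≡⟨ cong₂ _+_ (cong (h zero *_) (δ-≡ {x = zero {k}} refl))
                 (sumFin-zero k λ i → trans (cong (h (suc i) *_) (δ-≢ {x = suc i} {y = zero} λ ()))
                                            (*-zeroʳ (h (suc i)))) ⟩
  h zero * 1 + 0
    ≡⟨ trans (+-identityʳ _) (*-identityʳ (h zero)) ⟩
  h zero ∎
sumFin-*δ (suc k) h (suc j) = begin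
  sumFin (suc k) (λ i → h i * δ i (suc j))
    ≡⟨ cong₂ _+_ (trans (cong (h zero *_) (δ-≢ {x = zero} {y = suc j} λ ())) (*-zeroʳ (h zero)))
                 (sumFin-cong k (λ i → cong (h (suc i) *_) (δ-injective suc suc-injective i j))) ⟩
  sumFin k (λ i → h (suc i) * δ i j)
    ≡⟨ sumFin-*δ k (h ∘ suc) j ⟩
  h (suc j) ∎

sumFin-δ : ∀ k j → sumFin k (λ i → δ i j) ≡ 1
sumFin-δ k j = trans (sumFin-cong k (λ i → sym (*-identityˡ (δ i j)))) (sumFin-*δ k (λ _ → 1) j)

incid≡δ+δ : ∀ H e v → incid H e v ≡ δ (proj₁ (ends H e)) v + δ (proj₂ (ends H e)) v
incid≡δ+δ H e v with proj₁ (ends H e) ≟ᶠ v | proj₂ (ends H e) ≟ᶠ v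
... | yes _ | yes _ = refl
... | yes _ | no  _ = refl
... | no  _ | yes _ = refl
... | no  _ | no  _ = refl

↑ˡ≢↑ʳ : ∀ {a b} (v : Fin a) (i : Fin b) → v ↑ˡ b ≢ a ↑ʳ i
↑ˡ≢↑ʳ {a} {b} v i eq
  with trans (sym (splitAt-↑ˡ a v b)) (trans (cong (splitAt a) eq) (splitAt-↑ʳ a b i))
... | ()

δ-↑ˡ : ∀ {a} b (x y : Fin a) → δ (x ↑ˡ b) (y ↑ˡ b) ≡ δ x y
δ-↑ˡ b = δ-injective (_↑ˡ b) (↑ˡ-injective b _ _)

δ-↑ʳ : ∀ a {b} (x y : Fin b) → δ (a ↑ʳ x) (a ↑ʳ y) ≡ δ x y
δ-↑ʳ a = δ-injective (a ↑ʳ_) (↑ʳ-injective a _ _)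

δ-↑ˡ-↑ʳ : ∀ {a b} (x : Fin a) (i : Fin b) → δ (x ↑ˡ b) (a ↑ʳ i) ≡ 0
δ-↑ˡ-↑ʳ x i = δ-≢ (↑ˡ≢↑ʳ x i)

δ-↑ʳ-↑ˡ : ∀ {a b} (i : Fin b) (x : Fin a) → δ (a ↑ʳ i) (x ↑ˡ b) ≡ 0
δ-↑ʳ-↑ˡ i x = δ-≢ (↑ˡ≢↑ʳ x i ∘ sym)

↑-ind : ∀ {a b} (Q : Fin (a + b) → Set) →
        (∀ v → Q (v ↑ˡ b)) → (∀ i → Q (a ↑ʳ i)) → ∀ u → Q u
↑-ind {a} Q old new u with splitAt a u in eq
... | inj₁ v = subst Q (splitAt⁻¹-↑ˡ eq) (old v)
... | inj₂ i = subst Q (splitAt⁻¹-↑ʳ eq) (new i)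

-- Arithmetic modulo 4

-- a − b modulo 4, written with 3 ≡ −1 to avoid truncated subtraction
_⊖_ : ℕ → ℕ → Fin 4
a ⊖ b = (a + 3 * b) mod 4

toℕ-⊖ : ∀ a b → toℕ (a ⊖ b) ≡ (a + 3 * b) % 4
toℕ-⊖ a b = toℕ-fromℕ< (m%n<n (a + 3 * b) 4)

%-congˡ-+ : ∀ x y z d .{{_ : NonZero d}} → x % d ≡ y % d → (x + z) % d ≡ (y + z) % d
%-congˡ-+ x y z d x≡y = begin
  (x + z) % d           ≡⟨ %-distribˡ-+ x z d ⟩
  (x % d + z % d) % d   ≡⟨ cong (λ r → (r + z % d) % d) x≡y ⟩
  (y % d + z % d) % d   ≡⟨ %-distribˡ-+ y z d ⟨
  (y + z) % d           ∎

⊖-+-cancel : ∀ a b → (toℕ (a ⊖ b) + b) % 4 ≡ a % 4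
⊖-+-cancel a b = begin
  (toℕ (a ⊖ b) + b) % 4   ≡⟨ %-congˡ-+ (toℕ (a ⊖ b)) (a + 3 * b) b 4 ⊖≡ ⟩
  (a + 3 * b + b) % 4     ≡⟨ cong (_% 4) (+-*4 a b) ⟩
  (a + b * 4) % 4         ≡⟨ [m+kn]%n≡m%n a b 4 ⟩
  a % 4                   ∎
  where
  ⊖≡ : toℕ (a ⊖ b) % 4 ≡ (a + 3 * b) % 4
  ⊖≡ = trans (cong (_% 4) (toℕ-⊖ a b)) (m%n%n≡m%n (a + 3 * b) 4)
  +-*4 : ∀ a b → a + 3 * b + b ≡ a + b * 4
  +-*4 = solve-∀

2∣⊖+ : ∀ a b → 2 ∣ toℕ (a ⊖ b) + (a + b)
2∣⊖+ a b = ∣m+n∣m⇒∣n (divides (a + 2 * b) sum≡) (divides (q * 2) (sym (*-assoc q 2 2)))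
  where
  q = (a + 3 * b) / 4
  sum≡ : q * 4 + (toℕ (a ⊖ b) + (a + b)) ≡ (a + 2 * b) * 2
  sum≡ = begin
    q * 4 + (toℕ (a ⊖ b) + (a + b))     ≡⟨ cong (λ r → q * 4 + (r + (a + b))) (toℕ-⊖ a b) ⟩
    q * 4 + ((a + 3 * b) % 4 + (a + b)) ≡⟨ rearrange ((a + 3 * b) % 4) q (a + b) ⟩
    ((a + 3 * b) % 4 + q * 4) + (a + b) ≡⟨ cong (_+ (a + b)) (m≡m%n+[m/n]*n (a + 3 * b) 4) ⟨
    (a + 3 * b) + (a + b)               ≡⟨ double a b ⟩
    (a + 2 * b) * 2                     ∎
    where
    rearrange : ∀ r q s → q * 4 + (r + s) ≡ (r + q * 4) + s
    rearrange = solve-∀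
    double : ∀ a b → (a + 3 * b) + (a + b) ≡ (a + 2 * b) * 2
    double = solve-∀

2∣-chain : ∀ {r} a b c d → 2 ∣ r + (a + d) → 2 ∣ a + b → 2 ∣ b + c → 2 ∣ c + d → 2 ∣ r
2∣-chain {r} a b c d r+a+d a+b b+c c+d = ∣m+n∣m⇒∣n 2∣[a+b+c+d]*2+r (n∣m*n (a + b + c + d))
  where
  regroup : ∀ r a b c d → r + (a + d) + ((a + b) + ((b + c) + (c + d))) ≡ (a + b + c + d) * 2 + r
  regroup = solve-∀
  2∣[a+b+c+d]*2+r : 2 ∣ (a + b + c + d) * 2 + r
  2∣[a+b+c+d]*2+r = subst (2 ∣_) (regroup r a b c d)
    (∣m∣n⇒∣m+n r+a+d (∣m∣n⇒∣m+n a+b (∣m∣n⇒∣m+n b+c c+d)))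

δ-⊖ : ∀ (c t s : Fin 4) → δ (toℕ c ⊖ toℕ t) s ≡ δ t (toℕ c ⊖ toℕ s)
δ-⊖ = toWitness {a? = all? λ c → all? λ t → all? λ s →
                        δ (toℕ c ⊖ toℕ t) s ≟ δ t (toℕ c ⊖ toℕ s)} _

-- Labelling the edges of an ear

-- The ear edge labels when the first edge gets t and the i-th inner vertex must get degree g i.
propagate : ∀ k → (Fin k → Fin 4) → Fin 4 → Fin (suc k) → Fin 4
propagate k       g t zero    = t
propagate (suc k) g t (suc i) = propagate k (g ∘ suc) (toℕ (g zero) ⊖ toℕ t) i

propagate-suc : ∀ k g t (i : Fin k) →
                propagate k g t (suc i) ≡ toℕ (g i) ⊖ toℕ (propagate k g t (inject₁ i))
propagate-suc (suc k) g t zero    = refl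
propagate-suc (suc k) g t (suc i) = propagate-suc k (g ∘ suc) (toℕ (g zero) ⊖ toℕ t) i

zeroStart : ∀ k → (Fin k → Fin 4) → Fin (suc k) → Fin 4
zeroStart k       g zero    = zero
zeroStart (suc k) g (suc i) = toℕ (g zero) ⊖ toℕ (zeroStart k (g ∘ suc) i)

δ-propagate : ∀ k g t i → δ (propagate k g t i) zero ≡ δ t (zeroStart k g i)
δ-propagate k       g t zero    = refl
δ-propagate (suc k) g t (suc i) =
  trans (δ-propagate k (g ∘ suc) (toℕ (g zero) ⊖ toℕ t) i)
        (δ-⊖ (g zero) t (zeroStart k (g ∘ suc) i))

zeroCount : ∀ {K} → (Fin K → Fin 4) → ℕ
zeroCount {K} x = sumFin K (λ i → δ (x i) zero)

sumFin-zeroCount-propagate : ∀ k g → sumFin 4 (λ t → zeroCount (propagate k g t)) ≡ suc k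
sumFin-zeroCount-propagate k g = begin
  sumFin 4 (λ t → sumFin (suc k) (λ i → δ (propagate k g t i) zero))
    ≡⟨ sumFin-cong 4 (λ t → sumFin-cong (suc k) (δ-propagate k g t)) ⟩
  sumFin 4 (λ t → sumFin (suc k) (λ i → δ t (zeroStart k g i)))
    ≡⟨ sumFin-comm 4 (suc k) (λ t i → δ t (zeroStart k g i)) ⟩
  sumFin (suc k) (λ i → sumFin 4 (λ t → δ t (zeroStart k g i)))
    ≡⟨ sumFin-cong (suc k) (λ i → sumFin-δ 4 (zeroStart k g i)) ⟩
  sumFin (suc k) (λ _ → 1)
    ≡⟨ sumFin-1 (suc k) ⟩
  suc k ∎

AtMostOneZero : ∀ {K} → (Fin K → Fin 4) → Set
AtMostOneZero x = ∀ {i j} → x i ≡ zero → x j ≡ zero → i ≡ j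

zeroCount≤1⇒atMostOneZero : ∀ {K} (x : Fin K → Fin 4) → zeroCount x ≤ 1 → AtMostOneZero x
zeroCount≤1⇒atMostOneZero {K} x count≤1 {i} {j} xᵢ≡0 xⱼ≡0 with i ≟ᶠ j
... | yes i≡j = i≡j
... | no  i≢j = contradiction (≤-trans two≤count count≤1) λ { (s≤s ()) }
  where
  two≤count : 2 ≤ zeroCount x
  two≤count = subst (_≤ zeroCount x) (cong₂ _+_ (δ-≡ xᵢ≡0) (δ-≡ xⱼ≡0))
                    (sumFin-≥-pair K (λ i → δ (x i) zero) i≢j)

∃-atMostOneZero-propagate : ∀ k g → k < 7 → ∃ λ t → AtMostOneZero (propagate k g t)
∃-atMostOneZero-propagate k g k<7
  with pigeonhole 4 2 (λ t → zeroCount (propagate k g t))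
         (subst (_< 8) (sym (sumFin-zeroCount-propagate k g)) (s≤s k<7))
... | t , count<2 = t , zeroCount≤1⇒atMostOneZero (propagate k g t) (≤-pred count<2)

atMostOneZero-split : ∀ {K} (x : Fin K → Fin 4) → AtMostOneZero x → ∀ J →
                      (∀ i → toℕ i < J → x i ≢ zero) ⊎ (∀ i → J ≤ toℕ i → x i ≢ zero)
atMostOneZero-split x unique J with any? (λ i → (toℕ i <? J) ×-dec (x i ≟ᶠ zero))
... | no  ∄zero = inj₁ λ i i<J xᵢ≡0 → ∄zero (i , i<J , xᵢ≡0)
... | yes (i , i<J , xᵢ≡0) =
  inj₂ λ j J≤j xⱼ≡0 → <-irrefl (cong toℕ (unique xᵢ≡0 xⱼ≡0)) (<-≤-trans i<J J≤j)

-- Walks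

Joins-sym : ∀ H {e u w} → Joins H e u w → Joins H e w u
Joins-sym H (inj₁ eq) = inj₂ eq
Joins-sym H (inj₂ eq) = inj₁ eq

IsPath : ∀ H K → (Fin (suc (suc K)) → Fin (n H)) → (Fin (suc K) → Fin (m H)) → Set
IsPath H K P E = ∀ i → Joins H (E i) (P (inject₁ i)) (P (suc i))

module _ {H : Graph} {S : Fin (m H) → Set} where

  Reach-trans : ∀ {u v w} → Reach H S u v → Reach H S v w → Reach H S u w
  Reach-trans here              r′ = r′
  Reach-trans (step e s e∶uw r) r′ = step e s e∶uw (Reach-trans r r′)

  Reach-sym : ∀ {u v} → Reach H S u v → Reach H S v u
  Reach-sym here              = here
  Reach-sym (step e s e∶uw r) = Reach-trans (Reach-sym r) (step e s (Joins-sym H e∶uw) here)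

  Reach-path-start : ∀ K P {E} → IsPath H K P E →
                     ∀ J → (∀ i → toℕ i < toℕ J → S (E i)) → Reach H S (P J) (P zero)
  Reach-path-start K       P path zero       usable = here
  Reach-path-start zero    P path (suc zero) usable =
    step _ (usable zero (s≤s z≤n)) (Joins-sym H (path zero)) here
  Reach-path-start (suc K) P path (suc J)    usable =
    Reach-trans (Reach-path-start K (P ∘ suc) (path ∘ suc) J (λ i i<J → usable (suc i) (s≤s i<J)))
                (step _ (usable zero (s≤s z≤n)) (Joins-sym H (path zero)) here)

  Reach-path-end : ∀ K P {E} → IsPath H K P E →
                   ∀ J → (∀ i → toℕ J ≤ toℕ i → S (E i)) → Reach H S (P J) (P (fromℕ (suc K)))
  Reach-path-end zero    P path zero       usable = step _ (usable zero z≤n) (path zero) here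
  Reach-path-end zero    P path (suc zero) usable = here
  Reach-path-end (suc K) P path zero       usable =
    step _ (usable zero z≤n) (path zero)
         (Reach-path-end K (P ∘ suc) (path ∘ suc) zero (λ i _ → usable (suc i) z≤n))
  Reach-path-end (suc K) P path (suc J)    usable =
    Reach-path-end K (P ∘ suc) (path ∘ suc) J (λ i J≤i → usable (suc i) (s≤s J≤i))

Reach-map : ∀ {G H S T} (φ : Fin (n G) → Fin (n H)) (ψ : Fin (m G) → Fin (m H)) →
            (∀ {e u w} → Joins G e u w → Joins H (ψ e) (φ u) (φ w)) →
            (∀ {e} → S e → T (ψ e)) →
            ∀ {u v} → Reach G S u v → Reach H T (φ u) (φ v)
Reach-map φ ψ joins usable here              = here
Reach-map φ ψ joins usable (step e s e∶uw r) =
  step (ψ e) (usable s) (joins e∶uw) (Reach-map φ ψ joins usable r)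

Support : ∀ {M} → (Fin M → Fin 4) → Fin M → Set
Support x e = x e ≢ zero

-- Adding an ear

inner-fromℕ : ∀ k → inner k (fromℕ k) ≡ inj₂ tt
inner-fromℕ zero    = refl
inner-fromℕ (suc k) rewrite inner-fromℕ k = refl

inner-inject₁ : ∀ k (i : Fin k) → inner k (inject₁ i) ≡ inj₁ i
inner-inject₁ (suc k) zero    = refl
inner-inject₁ (suc k) (suc i) rewrite inner-inject₁ k i = refl

module Ear (G : Graph) (k : ℕ) (v0 vl : Fin (n G)) where

  G′ : Graph
  G′ = addEar G k v0 vl

  P : Fin (suc (suc k)) → Fin (n G′)
  P = earVert (n G) k v0 vl

  P-inner : ∀ i → P (suc (inject₁ i)) ≡ n G ↑ʳ i
  P-inner i rewrite inner-inject₁ k i = refl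

  P-last : P (fromℕ (suc k)) ≡ vl ↑ˡ k
  P-last rewrite inner-fromℕ k = refl

  ends-old : ∀ e → ends G′ (e ↑ˡ suc k) ≡ (proj₁ (ends G e) ↑ˡ k , proj₂ (ends G e) ↑ˡ k)
  ends-old e rewrite splitAt-↑ˡ (m G) e (suc k) = refl

  ends-ear : ∀ i → ends G′ (m G ↑ʳ i) ≡ (P (inject₁ i) , P (suc i))
  ends-ear i rewrite splitAt-↑ʳ (m G) (suc k) i = refl

  Joins-old : ∀ {e u w} → Joins G e u w → Joins G′ (e ↑ˡ suc k) (u ↑ˡ k) (w ↑ˡ k)
  Joins-old {e} (inj₁ refl) = inj₁ (ends-old e)
  Joins-old {e} (inj₂ refl) = inj₂ (ends-old e)

  ear-isPath : IsPath G′ k P (m G ↑ʳ_)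
  ear-isPath i = inj₁ (ends-ear i)

  incid-old-edge : ∀ e u → incid G′ (e ↑ˡ suc k) u
                         ≡ δ (proj₁ (ends G e) ↑ˡ k) u + δ (proj₂ (ends G e) ↑ˡ k) u
  incid-old-edge e u = trans (incid≡δ+δ G′ (e ↑ˡ suc k) u)
                             (cong (λ ends′ → δ (proj₁ ends′) u + δ (proj₂ ends′) u) (ends-old e))

  incid-old : ∀ e v → incid G′ (e ↑ˡ suc k) (v ↑ˡ k) ≡ incid G e v
  incid-old e v = trans (incid-old-edge e (v ↑ˡ k))
    (trans (cong₂ _+_ (δ-↑ˡ k (proj₁ (ends G e)) v) (δ-↑ˡ k (proj₂ (ends G e)) v))
           (sym (incid≡δ+δ G e v)))

  incid-old-inner : ∀ e i → incid G′ (e ↑ˡ suc k) (n G ↑ʳ i) ≡ 0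
  incid-old-inner e i = trans (incid-old-edge e (n G ↑ʳ i))
    (cong₂ _+_ (δ-↑ˡ-↑ʳ (proj₁ (ends G e)) i) (δ-↑ˡ-↑ʳ (proj₂ (ends G e)) i))

  incid-ear : ∀ i u → incid G′ (m G ↑ʳ i) u ≡ δ (P (inject₁ i)) u + δ (P (suc i)) u
  incid-ear i u = trans (incid≡δ+δ G′ (m G ↑ʳ i) u)
                        (cong (λ ends′ → δ (proj₁ ends′) u + δ (proj₂ ends′) u) (ends-ear i))

  extend : (Fin (m G) → Fin 4) → (Fin (suc k) → Fin 4) → Fin (m G′) → Fin 4
  extend y w e = [ y , w ] (splitAt (m G) e)

  endLoad : (Fin (suc k) → Fin 4) → Fin (n G) → ℕ
  endLoad w v = toℕ (w zero) * δ v v0 + toℕ (w (fromℕ k)) * δ v vl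

  innerDegree : (Fin (suc k) → Fin 4) → Fin k → ℕ
  innerDegree w i = toℕ (w (suc i)) + toℕ (w (inject₁ i))

  module _ (y : Fin (m G) → Fin 4) (w : Fin (suc k) → Fin 4) where

    extend-old : ∀ e → extend y w (e ↑ˡ suc k) ≡ y e
    extend-old e rewrite splitAt-↑ˡ (m G) e (suc k) = refl

    extend-ear : ∀ i → extend y w (m G ↑ʳ i) ≡ w i
    extend-ear i rewrite splitAt-↑ʳ (m G) (suc k) i = refl

    private
      w₀ wₗ : ℕ
      w₀ = toℕ (w zero)
      wₗ = toℕ (w (fromℕ k))

    degSum-extend : ∀ u → degSum G′ (extend y w) u ≡
        sumFin (m G) (λ e → toℕ (y e) * incid G′ (e ↑ˡ suc k) u)
      + (w₀ * δ (P zero) u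
         + sumFin k (λ i → innerDegree w i * δ (P (suc (inject₁ i))) u)
         + wₗ * δ (P (fromℕ (suc k))) u)
    degSum-extend u = begin
      degSum G′ (extend y w) u
        ≡⟨ sumFin-++ (m G) (suc k) (λ e → toℕ (extend y w e) * incid G′ e u) ⟩
      sumFin (m G) (λ e → toℕ (extend y w (e ↑ˡ suc k)) * incid G′ (e ↑ˡ suc k) u)
        + sumFin (suc k) (λ i → toℕ (extend y w (m G ↑ʳ i)) * incid G′ (m G ↑ʳ i) u)
        ≡⟨ cong₂ _+_
             (sumFin-cong (m G) λ e → cong (λ l → toℕ l * incid G′ (e ↑ˡ suc k) u) (extend-old e))
             (sumFin-cong (suc k) λ i → cong₂ _*_ (cong toℕ (extend-ear i)) (incid-ear i u)) ⟩
      sumFin (m G) (λ e → toℕ (y e) * incid G′ (e ↑ˡ suc k) u)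
        + sumFin (suc k) (λ i → toℕ (w i) * (δ (P (inject₁ i)) u + δ (P (suc i)) u))
        ≡⟨ cong (sumFin (m G) (λ e → toℕ (y e) * incid G′ (e ↑ˡ suc k) u) +_)
                (sumFin-path k (toℕ ∘ w) (λ j → δ (P j) u)) ⟩
      sumFin (m G) (λ e → toℕ (y e) * incid G′ (e ↑ˡ suc k) u)
        + (w₀ * δ (P zero) u
           + sumFin k (λ i → innerDegree w i * δ (P (suc (inject₁ i))) u)
           + wₗ * δ (P (fromℕ (suc k))) u) ∎

    degSum-old : ∀ v → degSum G′ (extend y w) (v ↑ˡ k) ≡ degSum G y v + endLoad w v
    degSum-old v = begin
      degSum G′ (extend y w) (v ↑ˡ k)
        ≡⟨ degSum-extend (v ↑ˡ k) ⟩
      sumFin (m G) (λ e → toℕ (y e) * incid G′ (e ↑ˡ suc k) (v ↑ˡ k))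
        + (w₀ * δ (P zero) (v ↑ˡ k)
           + sumFin k (λ i → innerDegree w i * δ (P (suc (inject₁ i))) (v ↑ˡ k))
           + wₗ * δ (P (fromℕ (suc k))) (v ↑ˡ k))
        ≡⟨ cong₂ _+_ (sumFin-cong (m G) (λ e → cong (toℕ (y e) *_) (incid-old e v)))
                     (cong₂ _+_ (cong₂ _+_ (cong (w₀ *_) start) middle) (cong (wₗ *_) end)) ⟩
      degSum G y v + (w₀ * δ v v0 + 0 + wₗ * δ v vl)
        ≡⟨ cong (λ s → degSum G y v + (s + wₗ * δ v vl)) (+-identityʳ _) ⟩
      degSum G y v + endLoad w v ∎
      where
      start : δ (P zero) (v ↑ˡ k) ≡ δ v v0
      start = trans (δ-↑ˡ k v0 v) (δ-sym v0 v)
      middle : sumFin k (λ i → innerDegree w i * δ (P (suc (inject₁ i))) (v ↑ˡ k)) ≡ 0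
      middle = sumFin-zero k λ i →
        trans (cong (λ p → innerDegree w i * δ p (v ↑ˡ k)) (P-inner i))
              (trans (cong (innerDegree w i *_) (δ-↑ʳ-↑ˡ i v)) (*-zeroʳ (innerDegree w i)))
      end : δ (P (fromℕ (suc k))) (v ↑ˡ k) ≡ δ v vl
      end = trans (cong (λ p → δ p (v ↑ˡ k)) P-last) (trans (δ-↑ˡ k vl v) (δ-sym vl v))

    degSum-inner : ∀ i → degSum G′ (extend y w) (n G ↑ʳ i) ≡ innerDegree w i
    degSum-inner i = begin
      degSum G′ (extend y w) (n G ↑ʳ i)
        ≡⟨ degSum-extend (n G ↑ʳ i) ⟩
      sumFin (m G) (λ e → toℕ (y e) * incid G′ (e ↑ˡ suc k) (n G ↑ʳ i))
        + (w₀ * δ (P zero) (n G ↑ʳ i)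
           + sumFin k (λ j → innerDegree w j * δ (P (suc (inject₁ j))) (n G ↑ʳ i))
           + wₗ * δ (P (fromℕ (suc k))) (n G ↑ʳ i))
        ≡⟨ cong₂ _+_ old
             (cong₂ _+_ (cong₂ _+_ (cong (w₀ *_) (δ-↑ˡ-↑ʳ v0 i)) middle) (cong (wₗ *_) end)) ⟩
      0 + (w₀ * 0 + sumFin k (λ j → innerDegree w j * δ j i) + wₗ * 0)
        ≡⟨ drop-zeros w₀ _ wₗ ⟩
      sumFin k (λ j → innerDegree w j * δ j i)
        ≡⟨ sumFin-*δ k (innerDegree w) i ⟩
      innerDegree w i ∎
      where
      old : sumFin (m G) (λ e → toℕ (y e) * incid G′ (e ↑ˡ suc k) (n G ↑ʳ i)) ≡ 0
      old = sumFin-zero (m G) λ e →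
        trans (cong (toℕ (y e) *_) (incid-old-inner e i)) (*-zeroʳ (toℕ (y e)))
      middle : sumFin k (λ j → innerDegree w j * δ (P (suc (inject₁ j))) (n G ↑ʳ i))
            ≡ sumFin k (λ j → innerDegree w j * δ j i)
      middle = sumFin-cong k λ j →
        cong (innerDegree w j *_) (trans (cong (λ p → δ p (n G ↑ʳ i)) (P-inner j)) (δ-↑ʳ (n G) j i))
      end : δ (P (fromℕ (suc k))) (n G ↑ʳ i) ≡ 0
      end = trans (cong (λ p → δ p (n G ↑ʳ i)) P-last) (δ-↑ˡ-↑ʳ vl i)
      drop-zeros : ∀ a s b → 0 + (a * 0 + s + b * 0) ≡ s
      drop-zeros = solve-∀

    extend-connected : ConnectedVia G (Support y) → AtMostOneZero w →
                       ConnectedVia G′ (Support (extend y w))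
    extend-connected y-connected unique u u′ = Reach-trans (to-v0 u) (Reach-sym (to-v0 u′))
      where
      old : ∀ {u v} → Reach G (Support y) u v →
            Reach G′ (Support (extend y w)) (u ↑ˡ k) (v ↑ˡ k)
      old = Reach-map (_↑ˡ k) (_↑ˡ suc k) Joins-old
                      (λ {e} yₑ≢0 → yₑ≢0 ∘ trans (sym (extend-old e)))
      ear-open : ∀ {i} → w i ≢ zero → Support (extend y w) (m G ↑ʳ i)
      ear-open {i} wᵢ≢0 = wᵢ≢0 ∘ trans (sym (extend-ear i))
      inner-to-v0 : ∀ i → Reach G′ (Support (extend y w)) (n G ↑ʳ i) (v0 ↑ˡ k)
      inner-to-v0 i with atMostOneZero-split w unique (suc (toℕ (inject₁ i)))
      ... | inj₁ before = subst (λ p → Reach G′ _ p (v0 ↑ˡ k)) (P-inner i)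
              (Reach-path-start k P ear-isPath (suc (inject₁ i)) (λ j j<i → ear-open (before j j<i)))
      ... | inj₂ after = subst (λ p → Reach G′ _ p (v0 ↑ˡ k)) (P-inner i)
              (Reach-trans (subst (Reach G′ _ (P (suc (inject₁ i)))) P-last
                             (Reach-path-end k P ear-isPath (suc (inject₁ i))
                                             (λ j i≤j → ear-open (after j i≤j))))
                           (old (y-connected vl v0)))
      to-v0 : ∀ u → Reach G′ (Support (extend y w)) u (v0 ↑ˡ k)
      to-v0 = ↑-ind _ (λ v → old (y-connected v v0)) inner-to-v0

  sumFin-endLoad : ∀ w → sumFin (n G) (endLoad w) ≡ toℕ (w zero) + toℕ (w (fromℕ k))
  sumFin-endLoad w =
    trans (sumFin-distrib-+ (n G) (λ v → toℕ (w zero) * δ v v0) (λ v → toℕ (w (fromℕ k)) * δ v vl))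
          (cong₂ _+_ (sumFin-*δ (n G) (λ _ → toℕ (w zero)) v0)
                     (sumFin-*δ (n G) (λ _ → toℕ (w (fromℕ k))) vl))

  innerTarget : (Fin (n G′) → Fin 4) → Fin k → Fin 4
  innerTarget f i = f (n G ↑ʳ i)

  reducedTarget : (Fin (n G′) → Fin 4) → (Fin (suc k) → Fin 4) → Fin (n G) → Fin 4
  reducedTarget f w v = toℕ (f (v ↑ˡ k)) ⊖ endLoad w v

  module _ (f : Fin (n G′) → Fin 4) (t : Fin 4) where

    private
      w : Fin (suc k) → Fin 4
      w = propagate k (innerTarget f) t

    innerDegree-≡ : ∀ i → innerDegree w i
                        ≡ toℕ (toℕ (innerTarget f i) ⊖ toℕ (w (inject₁ i))) + toℕ (w (inject₁ i))
    innerDegree-≡ i = cong (λ l → toℕ l + toℕ (w (inject₁ i))) (propagate-suc k (innerTarget f) t i)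

    innerDegree-mod4 : ∀ i → innerDegree w i % 4 ≡ toℕ (innerTarget f i) % 4
    innerDegree-mod4 i = trans (cong (_% 4) (innerDegree-≡ i))
                               (⊖-+-cancel (toℕ (innerTarget f i)) (toℕ (w (inject₁ i))))

    innerDegree-parity : ∀ i → 2 ∣ toℕ (innerTarget f i) + innerDegree w i
    innerDegree-parity i =
      subst (2 ∣_) (trans (swap (toℕ (g ⊖ wᵢ)) g wᵢ) (cong (g +_) (sym (innerDegree-≡ i)))) (2∣⊖+ g wᵢ)
      where
      g wᵢ : ℕ
      g  = toℕ (innerTarget f i)
      wᵢ = toℕ (w (inject₁ i))
      swap : ∀ x a b → x + (a + b) ≡ a + (x + b)
      swap = solve-∀

    reducedTarget-even : 2 ∣ sumFin (n G′) (toℕ ∘ f) →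
                         2 ∣ sumFin (n G) (toℕ ∘ reducedTarget f w)
    reducedTarget-even f-even =
      2∣-chain (sumFin (n G) f-old) (sumFin k f-inner) (sumFin k (innerDegree w)) w-ends
               reduced+old+ends old+inner inner+pairs pairs+ends
      where
      f-old f-inner : Fin _ → ℕ
      f-old v   = toℕ (f (v ↑ˡ k))
      f-inner i = toℕ (innerTarget f i)

      w-ends : ℕ
      w-ends = toℕ (w zero) + toℕ (w (fromℕ k))

      old+inner : 2 ∣ sumFin (n G) f-old + sumFin k f-inner
      old+inner = subst (2 ∣_) (sumFin-++ (n G) k (toℕ ∘ f)) f-even

      inner+pairs : 2 ∣ sumFin k f-inner + sumFin k (innerDegree w)
      inner+pairs = subst (2 ∣_) (sumFin-distrib-+ k f-inner (innerDegree w))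
                          (∣-sumFin k (λ i → f-inner i + innerDegree w i) innerDegree-parity)

      pairs+ends : 2 ∣ sumFin k (innerDegree w) + w-ends
      pairs+ends = subst (2 ∣_) (sym (sumFin-adjacent k (toℕ ∘ w)))
                         (divides (sumFin (suc k) (toℕ ∘ w)) (*-comm 2 (sumFin (suc k) (toℕ ∘ w))))

      reduced+old+ends : 2 ∣ sumFin (n G) (toℕ ∘ reducedTarget f w) + (sumFin (n G) f-old + w-ends)
      reduced+old+ends = subst (2 ∣_) sums
        (∣-sumFin (n G) (λ v → toℕ (reducedTarget f w v) + (f-old v + endLoad w v))
                  λ v → 2∣⊖+ (f-old v) (endLoad w v))
        where
        sums : sumFin (n G) (λ v → toℕ (reducedTarget f w v) + (f-old v + endLoad w v))
             ≡ sumFin (n G) (toℕ ∘ reducedTarget f w) + (sumFin (n G) f-old + w-ends)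
        sums = trans (sumFin-distrib-+ (n G) (toℕ ∘ reducedTarget f w) (λ v → f-old v + endLoad w v))
                     (cong (sumFin (n G) (toℕ ∘ reducedTarget f w) +_)
                           (trans (sumFin-distrib-+ (n G) f-old (endLoad w))
                                  (cong (sumFin (n G) f-old +_) (sumFin-endLoad w))))

    extend-factor : ∀ y → ConnModFactor G (reducedTarget f w) y → AtMostOneZero w →
                    ConnModFactor G′ f (extend y w)
    extend-factor y (y-degree , y-connected) unique = ↑-ind _ old-degree inner-degree
                                                    , extend-connected y w y-connected unique
      where
      old-degree : ∀ v → degSum G′ (extend y w) (v ↑ˡ k) % 4 ≡ toℕ (f (v ↑ˡ k)) % 4
      old-degree v = begin
        degSum G′ (extend y w) (v ↑ˡ k) % 4
          ≡⟨ cong (_% 4) (degSum-old y w v) ⟩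
        (degSum G y v + endLoad w v) % 4
          ≡⟨ %-congˡ-+ (degSum G y v) (toℕ (reducedTarget f w v)) (endLoad w v) 4 (y-degree v) ⟩
        (toℕ (reducedTarget f w v) + endLoad w v) % 4
          ≡⟨ ⊖-+-cancel (toℕ (f (v ↑ˡ k))) (endLoad w v) ⟩
        toℕ (f (v ↑ˡ k)) % 4 ∎

      inner-degree : ∀ i → degSum G′ (extend y w) (n G ↑ʳ i) % 4 ≡ toℕ (f (n G ↑ʳ i)) % 4
      inner-degree i = trans (cong (_% 4) (degSum-inner y w i)) (innerDegree-mod4 i)

lemma4p15 : (G : Graph) (k : ℕ) → suc k ≤ 7 → (v0 vl : Fin (n G))
    → Simple G → Simple (addEar G k v0 vl)
    → TwoEdgeConnected G → TwoEdgeConnected (addEar G k v0 vl)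
    → NonBipartite G → NonBipartite (addEar G k v0 vl)
    → AllRound G → AllRound (addEar G k v0 vl)
lemma4p15 G k k<7 v0 vl _ _ _ _ _ _ allRound f f-even =
  let open Ear G k v0 vl
      (t , unique)   = ∃-atMostOneZero-propagate k (innerTarget f) k<7
      w              = propagate k (innerTarget f) t
      (y , y-factor) = allRound (reducedTarget f w) (reducedTarget-even f t f-even)
  in extend y w , extend-factor f t y y-factor unique
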